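{- For integers $n\geq 2$ and $0\leq k\leq n-1$, let $C_{n,k}$ denote the number of inversion sequences $e\in\mathbf{I}_n(\geq,-,\geq)$ with $e_n=k$, where $C_{m,j}:=0$ whenever no such sequence exists (in particular $C_{n,-1}=0$ and $C_{n-1,n-1}=0$). Then $$C_{n,k}=C_{n,k-1}+C_{n-1,k}.$$
   Context: For $n\geq1$, $\mathbf{I}_n=\{(e_1,\ldots,e_n)\in\mathbb{Z}^n: 0\leq e_i<i \text{ for all } i\}$ is the set of inversion sequences of length $n$. For binary relations $\rho_1,\rho_2,\rho_3$ on $\mathbb{N}$, $\mathbf{I}_n(\rho_1,\rho_2,\rho_3)$ is the set of $e\in\mathbf{I}_n$ for which there are no indices $i<j<k$ with $e_i\,\rho_1\,e_j$, $e_j\,\rho_2\,e_k$ and $e_i\,\rho_3\,e_k$; the relation "$-$" holds for every pair. Thus $\mathbf{I}_n(\geq,-,\geq)$ is the set of $e\in\mathbf{I}_n$ with no $i<j<k$ such that $e_i\geq e_j$ and $e_i\geq e_k$. -}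

module Defs where

open import Data.Nat using (ℕ; zero; suc; _<_; _≥_; _≟_; _<?_; _≤?_)
open import Data.Fin using (Fin; toℕ)
import Data.Fin as F
open import Data.Fin.Properties using (all?)
open import Data.Vec using (Vec; []; _∷_; lookup; last)
open import Data.List using (List; [_]; concatMap; map; upTo; filter; length)
open import Data.Product using (_×_)
open import Relation.Nullary using (¬_; Dec)
open import Relation.Nullary.Decidable using (_×-dec_; _→-dec_; ¬?)
open import Relation.Binary.PropositionalEquality using (_≡_)

-- Sequences are 0-indexed: position i (0-based) corresponds to e_{i+1},
-- so the condition 0 ≤ e_{i+1} < i+1 reads  lookup e i < suc (toℕ i).
IsInvSeq : ∀ {n} → Vec ℕ n → Set
IsInvSeq {n} e = ∀ (i : Fin n) → lookup e i < suc (toℕ i)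

Avoids≥-≥ : ∀ {n} → Vec ℕ n → Set
Avoids≥-≥ {n} e = ∀ (i j k : Fin n) → i F.< j → j F.< k →
  ¬ (lookup e i ≥ lookup e j × lookup e i ≥ lookup e k)

isInvSeq? : ∀ {n} (e : Vec ℕ n) → Dec (IsInvSeq e)
isInvSeq? e = all? (λ i → lookup e i <? suc (toℕ i))

avoids? : ∀ {n} (e : Vec ℕ n) → Dec (Avoids≥-≥ e)
avoids? e = all? λ i → all? λ j → all? λ k →
  (i F.<? j) →-dec (j F.<? k) →-dec
  ¬? ((lookup e j ≤? lookup e i) ×-dec (lookup e k ≤? lookup e i))

allVecs : (m n : ℕ) → List (Vec ℕ n)
allVecs m zero = [ [] ]
allVecs m (suc n) = concatMap (λ x → map (x ∷_) (allVecs m n)) (upTo m)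

-- Every inversion sequence of length
-- n has entries < n, so filtering {0..n-1}^n enumerates I_n exactly.
-- (C 0 k = 0 is a convention; the paper only uses n ≥ 1.)
C : ℕ → ℕ → ℕ
C zero k = 0
C (suc m) k = length (filter
  (λ e → (isInvSeq? e ×-dec avoids? e) ×-dec (last e ≟ k))
  (allVecs (suc m) (suc m)))

Cpred : ℕ → ℕ → ℕ
Cpred n zero = 0
Cpred n (suc k) = C n k

-- Read a sequence from left to right and record two numbers: its floor u, the least value that can be
-- appended without creating the pattern (≥,-,≥), and its last entry l.  Appending y ≥ u keeps the floor
-- when y > l and raises it to l + 1 otherwise, while the inversion condition only bounds y by the length.
-- Counting the sequences of length p + 1 by (u, l), the count turns out to depend on u + l only: it is
-- ballot p (u + l), where ballot (p + 1) is the sequence of partial sums of ballot p (cut off beyond the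
-- largest attainable value of u + l).  Summing over u gives C (p + 1) k = ballot (p + 1) (p + 1 + k), so
-- the recurrence of the theorem is the partial-sum recurrence of ballot.
module Submission where

open import Defs
open import Algebra.Properties.CommutativeSemigroup using (interchange)
open import Data.Bool using (true; false; if_then_else_)
open import Data.Empty using (⊥-elim)
open import Data.Fin as Fin using (Fin; toℕ; inject₁; fromℕ)
open import Data.Fin.Properties using (toℕ-inject₁; toℕ-fromℕ; toℕ<n)
open import Data.List using (List; []; _∷_; _++_; map; concatMap; applyUpTo; filter; length)
open import Data.List.Properties using (length-++; filter-++; filter-≐)
open import Data.Nat
open import Data.Nat.Properties
open import Data.Product using (Σ; _×_; _,_; proj₁; proj₂)
open import Data.Sum using (_⊎_; inj₁; inj₂; [_,_])
open import Data.Vec using (Vec; []; _∷_; _∷ʳ_; lookup; last; initLast; foldl)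
open import Data.Vec.Properties using (foldl-∷ʳ)
open import Function using (_∘_; id; _⇔_; mk⇔; Equivalence)
open import Level using (Level)
open import Relation.Binary.PropositionalEquality
  using (_≡_; _≢_; refl; sym; trans; cong; cong₂; subst; subst₂; module ≡-Reasoning)
open import Relation.Nullary using (Dec; yes; no; does; ¬_; contradiction)
open import Relation.Nullary.Decidable using (dec-true; dec-false; _×-dec_)
open import Relation.Unary using (Pred; Decidable; _≐_)

open Equivalence using (to; from)

private variable
  ℓ : Level
  A : Set
  n : ℕ

∑< : ℕ → (ℕ → ℕ) → ℕ
∑< zero    f = 0
∑< (suc n) f = f 0 + ∑< n (f ∘ suc)

syntax ∑< n (λ i → e) = ∑[ i < n ] e

∑-cong : ∀ n {f g : ℕ → ℕ} → (∀ i → i < n → f i ≡ g i) → ∑< n f ≡ ∑< n g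
∑-cong zero    eq = refl
∑-cong (suc n) eq = cong₂ _+_ (eq 0 z<s) (∑-cong n (λ i i<n → eq (suc i) (s<s i<n)))

∑-zero : ∀ n {f : ℕ → ℕ} → (∀ i → i < n → f i ≡ 0) → ∑< n f ≡ 0
∑-zero zero    eq = refl
∑-zero (suc n) eq = cong₂ _+_ (eq 0 z<s) (∑-zero n (λ i i<n → eq (suc i) (s<s i<n)))

∑-single : ∀ n {f : ℕ → ℕ} c → c < n → (∀ i → i < n → i ≢ c → f i ≡ 0) → ∑< n f ≡ f c
∑-single (suc n) {f} zero    _   eq =
  trans (cong (f 0 +_) (∑-zero n (λ i i<n → eq (suc i) (s<s i<n) λ ()))) (+-identityʳ (f 0))
∑-single (suc n) {f} (suc c) c<n eq =
  trans (cong (_+ ∑< n (f ∘ suc)) (eq 0 z<s λ ()))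
        (∑-single n c (s<s⁻¹ c<n) (λ i i<n i≢c → eq (suc i) (s<s i<n) (i≢c ∘ suc-injective)))

∑-distrib-+ : ∀ n (f g : ℕ → ℕ) → ∑[ i < n ] (f i + g i) ≡ ∑< n f + ∑< n g
∑-distrib-+ zero    f g = refl
∑-distrib-+ (suc n) f g =
  trans (cong (f 0 + g 0 +_) (∑-distrib-+ n (f ∘ suc) (g ∘ suc)))
        (interchange +-commutativeSemigroup (f 0) (g 0) _ _)

∑-comm : ∀ m n (f : ℕ → ℕ → ℕ) → ∑[ i < m ] ∑[ j < n ] f i j ≡ ∑[ j < n ] ∑[ i < m ] f i j
∑-comm zero    n f = sym (∑-zero n (λ _ _ → refl))
∑-comm (suc m) n f = trans (cong (∑< n (f 0) +_) (∑-comm m n (f ∘ suc))) (sym (∑-distrib-+ n (f 0) _))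

∑-+ : ∀ m n (f : ℕ → ℕ) → ∑< (m + n) f ≡ ∑< m f + ∑[ j < n ] f (m + j)
∑-+ zero    n f = refl
∑-+ (suc m) n f = trans (cong (f 0 +_) (∑-+ m n (f ∘ suc))) (sym (+-assoc (f 0) _ _))

∑-suc : ∀ n (f : ℕ → ℕ) → ∑< (suc n) f ≡ ∑< n f + f n
∑-suc n f = begin
  ∑< (suc n) f             ≡⟨ cong (λ m → ∑< m f) (+-comm 1 n) ⟩
  ∑< (n + 1) f             ≡⟨ ∑-+ n 1 f ⟩
  ∑< n f + (f (n + 0) + 0) ≡⟨ cong (∑< n f +_) (trans (+-identityʳ _) (cong f (+-identityʳ n))) ⟩
  ∑< n f + f n             ∎
  where open ≡-Reasoning

infix 5 _if?_

_if?_ : ∀ {P : Set ℓ} → ℕ → Dec P → ℕ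
x if? P? = if does P? then x else 0

if?-yes : ∀ {P : Set ℓ} (P? : Dec P) {x} → P → x if? P? ≡ x
if?-yes P? p = cong (if_then _ else 0) (dec-true P? p)

if?-no : ∀ {P : Set ℓ} (P? : Dec P) {x} → ¬ P → x if? P? ≡ 0
if?-no P? ¬p = cong (if_then _ else 0) (dec-false P? ¬p)

if?-zero : ∀ {P : Set ℓ} (P? : Dec P) → 0 if? P? ≡ 0
if?-zero P? with does P?
... | true  = refl
... | false = refl

if?-cong : ∀ {ℓ′} {P : Set ℓ} {Q : Set ℓ′} (P? : Dec P) (Q? : Dec Q) {x} → (P → Q) → (Q → P) →
           x if? P? ≡ x if? Q?
if?-cong P? Q? P→Q Q→P with P?
... | yes p = sym (if?-yes Q? (P→Q p))
... | no ¬p = sym (if?-no Q? (¬p ∘ Q→P))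

∑-truncate : ∀ {m} n (f : ℕ → ℕ) → n ≤ m → ∑[ i < m ] (f i if? (i <? n)) ≡ ∑< n f
∑-truncate {m} n f n≤m with (d , refl) ← m≤n⇒∃[o]m+o≡n n≤m = begin
  ∑[ i < n + d ] (f i if? (i <? n))
    ≡⟨ ∑-+ n d _ ⟩
  ∑[ i < n ] (f i if? (i <? n)) + ∑[ j < d ] (f (n + j) if? (n + j <? n))
    ≡⟨ cong₂ _+_ (∑-cong n (λ i i<n → if?-yes (i <? n) i<n))
                 (∑-zero d (λ j _ → if?-no (n + j <? n) (≤⇒≯ (m≤m+n n j)))) ⟩
  ∑< n f + 0
    ≡⟨ +-identityʳ _ ⟩
  ∑< n f ∎
  where open ≡-Reasoning

count : ∀ {P : Pred A ℓ} → Decidable P → List A → ℕ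
count P? = length ∘ filter P?

private variable
  P Q : Pred A ℓ

count-∷ : (P? : Decidable P) → ∀ x xs → count P? (x ∷ xs) ≡ (1 if? P? x) + count P? xs
count-∷ P? x xs with P? x
... | yes _ = refl
... | no  _ = refl

count-none : (P? : Decidable P) → ∀ xs → (∀ x → ¬ P x) → count P? xs ≡ 0
count-none P? []       ¬P = refl
count-none P? (x ∷ xs) ¬P = trans (count-∷ P? x xs) (cong₂ _+_ (if?-no (P? x) (¬P x)) (count-none P? xs ¬P))

count-≐ : (P? : Decidable P) (Q? : Decidable Q) → P ≐ Q → ∀ xs → count P? xs ≡ count Q? xs
count-≐ P? Q? P≐Q xs = cong length (filter-≐ P? Q? P≐Q xs)

count-×-const : ∀ {Q : Set ℓ} (Q? : Dec Q) (P? : Decidable P) xs →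
                count (λ x → Q? ×-dec P? x) xs ≡ count P? xs if? Q?
count-×-const (yes q) P? xs = count-≐ _ P? (proj₂ , (q ,_)) xs
count-×-const (no ¬q) P? xs = count-none _ xs (λ _ → ¬q ∘ proj₁)

count-++ : (P? : Decidable P) → ∀ xs ys → count P? (xs ++ ys) ≡ count P? xs + count P? ys
count-++ P? xs ys = trans (cong length (filter-++ P? xs ys)) (length-++ (filter P? xs))

count-map : ∀ {B : Set} (P? : Decidable P) (f : B → A) xs → count P? (map f xs) ≡ count (P? ∘ f) xs
count-map P? f []       = refl
count-map P? f (x ∷ xs) =
  trans (count-∷ P? (f x) (map f xs))
        (trans (cong (_ +_) (count-map P? f xs)) (sym (count-∷ (P? ∘ f) x xs)))

count-concatMap : (P? : Decidable P) (f : ℕ → List A) (g : ℕ → ℕ) (n : ℕ) →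
                  count P? (concatMap f (applyUpTo g n)) ≡ ∑[ i < n ] count P? (f (g i))
count-concatMap P? f g zero    = refl
count-concatMap P? f g (suc n) =
  trans (count-++ P? (f (g 0)) _) (cong (_ +_) (count-concatMap P? f (g ∘ suc) n))

count-partition : ∀ (P? : Decidable P) (s : A → ℕ) R → (∀ {x} → P x → s x < R) →
                  ∀ xs → count P? xs ≡ ∑[ a < R ] count (λ x → P? x ×-dec s x ≟ a) xs
count-partition P? s R bound []       = sym (∑-zero R (λ _ _ → refl))
count-partition P? s R bound (x ∷ xs) = begin
  count P? (x ∷ xs)
    ≡⟨ count-∷ P? x xs ⟩
  (1 if? P? x) + count P? xs
    ≡⟨ cong₂ _+_ head (count-partition P? s R bound xs) ⟩
  ∑[ a < R ] (1 if? (P? x ×-dec s x ≟ a)) + ∑[ a < R ] count (λ y → P? y ×-dec s y ≟ a) xs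
    ≡⟨ ∑-distrib-+ R _ _ ⟨
  ∑[ a < R ] ((1 if? (P? x ×-dec s x ≟ a)) + count (λ y → P? y ×-dec s y ≟ a) xs)
    ≡⟨ ∑-cong R (λ a _ → count-∷ (λ y → P? y ×-dec s y ≟ a) x xs) ⟨
  ∑[ a < R ] count (λ y → P? y ×-dec s y ≟ a) (x ∷ xs) ∎
  where
  open ≡-Reasoning
  head : (1 if? P? x) ≡ ∑[ a < R ] (1 if? (P? x ×-dec s x ≟ a))
  head with P? x
  ... | yes px = sym (trans (∑-single R (s x) (bound px)
                              (λ a _ a≢sx → if?-no (yes px ×-dec s x ≟ a) (a≢sx ∘ sym ∘ proj₂)))
                            (if?-yes (yes px ×-dec s x ≟ s x) (px , refl)))
  ... | no ¬px = sym (∑-zero R (λ a _ → if?-no (no ¬px ×-dec s x ≟ a) {1} (¬px ∘ proj₁)))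

count-allVecs-∷ : ∀ {P : Pred (Vec ℕ (suc n)) ℓ} (P? : Decidable P) B →
                  count P? (allVecs B (suc n)) ≡ ∑[ x < B ] count (P? ∘ (x ∷_)) (allVecs B n)
count-allVecs-∷ {n} P? B =
  trans (count-concatMap P? (λ x → map (x ∷_) (allVecs B n)) id B)
        (∑-cong B (λ x _ → count-map P? (x ∷_) (allVecs B n)))

count-allVecs-∷ʳ : ∀ {P : Pred (Vec ℕ (suc n)) ℓ} (P? : Decidable P) B →
                   count P? (allVecs B (suc n)) ≡ ∑[ y < B ] count (P? ∘ (_∷ʳ y)) (allVecs B n)
count-allVecs-∷ʳ {zero}  P? B =
  trans (count-allVecs-∷ P? B)
        (∑-cong B (λ y _ → trans (count-[] (P? ∘ (y ∷_))) (sym (count-[] (P? ∘ (_∷ʳ y))))))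
  where
  count-[] : ∀ {P : Pred (Vec ℕ 0) ℓ} (P? : Decidable P) → count P? (allVecs B 0) ≡ 1 if? P? []
  count-[] P? = trans (count-∷ P? [] []) (+-identityʳ _)
count-allVecs-∷ʳ {suc n} P? B = begin
  count P? (allVecs B (suc (suc n)))
    ≡⟨ count-allVecs-∷ P? B ⟩
  ∑[ x < B ] count (P? ∘ (x ∷_)) (allVecs B (suc n))
    ≡⟨ ∑-cong B (λ x _ → count-allVecs-∷ʳ (P? ∘ (x ∷_)) B) ⟩
  ∑[ x < B ] ∑[ y < B ] count (λ v → P? (x ∷ (v ∷ʳ y))) (allVecs B n)
    ≡⟨ ∑-comm B B _ ⟩
  ∑[ y < B ] ∑[ x < B ] count (λ v → P? ((x ∷ v) ∷ʳ y)) (allVecs B n)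
    ≡⟨ ∑-cong B (λ y _ → count-allVecs-∷ (P? ∘ (_∷ʳ y)) B) ⟨
  ∑[ y < B ] count (P? ∘ (_∷ʳ y)) (allVecs B (suc n)) ∎
  where open ≡-Reasoning

snoc-induction : (P : ∀ {n} → Vec A n → Set ℓ) → P [] → (∀ {n} (v : Vec A n) y → P v → P (v ∷ʳ y)) →
                 (v : Vec A n) → P v
snoc-induction P base step []      = base
snoc-induction P base step (x ∷ v) = snoc-induction (λ w → P (x ∷ w)) (step [] x base) (λ w → step (x ∷ w)) v

data SnocIndex : ∀ {n} → Fin (suc n) → Set where
  old : (i : Fin n) → SnocIndex (inject₁ i)
  new : SnocIndex (fromℕ n)

snocIndex : (i : Fin (suc n)) → SnocIndex i
snocIndex {zero}  Fin.zero    = new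
snocIndex {suc n} Fin.zero    = old Fin.zero
snocIndex {suc n} (Fin.suc i) with snocIndex i
... | old j = old (Fin.suc j)
... | new   = new

lookup-∷ʳ-inject₁ : ∀ (v : Vec A n) y i → lookup (v ∷ʳ y) (inject₁ i) ≡ lookup v i
lookup-∷ʳ-inject₁ (x ∷ v) y Fin.zero    = refl
lookup-∷ʳ-inject₁ (x ∷ v) y (Fin.suc i) = lookup-∷ʳ-inject₁ v y i

lookup-∷ʳ-fromℕ : ∀ (v : Vec A n) y → lookup (v ∷ʳ y) (fromℕ n) ≡ y
lookup-∷ʳ-fromℕ []      y = refl
lookup-∷ʳ-fromℕ (x ∷ v) y = lookup-∷ʳ-fromℕ v y

inject₁-mono : ∀ {i j : Fin n} → i Fin.< j → inject₁ i Fin.< inject₁ j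
inject₁-mono {i = i} {j} = subst₂ _<_ (sym (toℕ-inject₁ i)) (sym (toℕ-inject₁ j))

inject₁-mono⁻¹ : ∀ {i j : Fin n} → inject₁ i Fin.< inject₁ j → i Fin.< j
inject₁-mono⁻¹ {i = i} {j} = subst₂ _<_ (toℕ-inject₁ i) (toℕ-inject₁ j)

inject₁<fromℕ : ∀ (i : Fin n) → inject₁ i Fin.< fromℕ n
inject₁<fromℕ {n} i = subst₂ _<_ (sym (toℕ-inject₁ i)) (sym (toℕ-fromℕ n)) (toℕ<n i)

fromℕ≮ : ∀ (j : Fin (suc n)) → ¬ fromℕ n Fin.< j
fromℕ≮ {n} j n<j = <⇒≱ (subst (_< toℕ j) (toℕ-fromℕ n) n<j) (s≤s⁻¹ (toℕ<n j))

-- The pattern (≥,-,≥) under appending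

Good : Vec ℕ n → Set
Good e = IsInvSeq e × Avoids≥-≥ e

good? : (e : Vec ℕ n) → Dec (Good e)
good? e = isInvSeq? e ×-dec avoids? e

Dominates : ℕ → ℕ → ℕ → Set
Dominates a b c = a ≥ b × a ≥ c

dominates-cong : ∀ {a a′ b b′ c c′} → a ≡ a′ → b ≡ b′ → c ≡ c′ →
                 Dominates a b c → Dominates a′ b′ c′
dominates-cong refl refl refl d = d

CanAppend : Vec ℕ n → ℕ → Set
CanAppend {n} v y = ∀ (i j : Fin n) → i Fin.< j → ¬ Dominates (lookup v i) (lookup v j) y

EntryAtLeast : Vec ℕ n → ℕ → Set
EntryAtLeast {n} v t = Σ (Fin n) λ i → t ≤ lookup v i

module _ {n} (v : Vec ℕ n) (y : ℕ) where

  private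
    lookup-old = lookup-∷ʳ-inject₁ v y
    lookup-new = lookup-∷ʳ-fromℕ v y

  IsInvSeq-∷ʳ : IsInvSeq (v ∷ʳ y) ⇔ (IsInvSeq v × y ≤ n)
  IsInvSeq-∷ʳ = mk⇔ forth back
    where
    forth : IsInvSeq (v ∷ʳ y) → IsInvSeq v × y ≤ n
    forth inv = (λ i → subst₂ (λ a b → a < suc b) (lookup-old i) (toℕ-inject₁ i) (inv (inject₁ i)))
              , s≤s⁻¹ (subst₂ (λ a b → a < suc b) lookup-new (toℕ-fromℕ n) (inv (fromℕ n)))
    back : IsInvSeq v × y ≤ n → IsInvSeq (v ∷ʳ y)
    back (inv , y≤n) i with snocIndex i
    ... | old i₀ = subst₂ (λ a b → a < suc b) (sym (lookup-old i₀)) (sym (toℕ-inject₁ i₀)) (inv i₀)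
    ... | new    = subst₂ (λ a b → a < suc b) (sym lookup-new) (sym (toℕ-fromℕ n)) (s≤s y≤n)

  Avoids-∷ʳ : Avoids≥-≥ (v ∷ʳ y) ⇔ (Avoids≥-≥ v × CanAppend v y)
  Avoids-∷ʳ = mk⇔ forth back
    where
    forth : Avoids≥-≥ (v ∷ʳ y) → Avoids≥-≥ v × CanAppend v y
    forth av =
        (λ i j k i<j j<k → av (inject₁ i) (inject₁ j) (inject₁ k) (inject₁-mono i<j) (inject₁-mono j<k)
                           ∘ dominates-cong (sym (lookup-old i)) (sym (lookup-old j)) (sym (lookup-old k)))
      , (λ i j i<j → av (inject₁ i) (inject₁ j) (fromℕ n) (inject₁-mono i<j) (inject₁<fromℕ j)
                     ∘ dominates-cong (sym (lookup-old i)) (sym (lookup-old j)) (sym lookup-new))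
    back : Avoids≥-≥ v × CanAppend v y → Avoids≥-≥ (v ∷ʳ y)
    back (av , ca) i j k i<j j<k with snocIndex i | snocIndex j | snocIndex k
    ... | old i₀ | old j₀ | old k₀ = av i₀ j₀ k₀ (inject₁-mono⁻¹ i<j) (inject₁-mono⁻¹ j<k)
                                     ∘ dominates-cong (lookup-old i₀) (lookup-old j₀) (lookup-old k₀)
    ... | old i₀ | old j₀ | new    = ca i₀ j₀ (inject₁-mono⁻¹ i<j)
                                     ∘ dominates-cong (lookup-old i₀) (lookup-old j₀) lookup-new
    ... | _      | new    | _      = contradiction j<k (fromℕ≮ k)
    ... | new    | old _  | _      = contradiction i<j (fromℕ≮ j)

  EntryAtLeast-∷ʳ : ∀ {t} → EntryAtLeast (v ∷ʳ y) t ⇔ (EntryAtLeast v t ⊎ t ≤ y)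
  EntryAtLeast-∷ʳ {t} = mk⇔ forth back
    where
    forth : EntryAtLeast (v ∷ʳ y) t → EntryAtLeast v t ⊎ t ≤ y
    forth (i , t≤) with snocIndex i
    ... | old i₀ = inj₁ (i₀ , subst (t ≤_) (lookup-old i₀) t≤)
    ... | new    = inj₂ (subst (t ≤_) lookup-new t≤)
    back : EntryAtLeast v t ⊎ t ≤ y → EntryAtLeast (v ∷ʳ y) t
    back (inj₁ (i , t≤)) = inject₁ i , subst (t ≤_) (sym (lookup-old i)) t≤
    back (inj₂ t≤y)      = fromℕ n , subst (t ≤_) (sym lookup-new) t≤y

  CanAppend-∷ʳ : ∀ {x} → CanAppend (v ∷ʳ y) x ⇔ (CanAppend v x × (∀ i → ¬ Dominates (lookup v i) y x))
  CanAppend-∷ʳ {x} = mk⇔ forth back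
    where
    forth : CanAppend (v ∷ʳ y) x → CanAppend v x × (∀ i → ¬ Dominates (lookup v i) y x)
    forth ca =
        (λ i j i<j → ca (inject₁ i) (inject₁ j) (inject₁-mono i<j)
                     ∘ dominates-cong (sym (lookup-old i)) (sym (lookup-old j)) refl)
      , (λ i → ca (inject₁ i) (fromℕ n) (inject₁<fromℕ i)
               ∘ dominates-cong (sym (lookup-old i)) (sym lookup-new) refl)
    back : CanAppend v x × (∀ i → ¬ Dominates (lookup v i) y x) → CanAppend (v ∷ʳ y) x
    back (ca , ca′) i j i<j with snocIndex i | snocIndex j
    ... | old i₀ | old j₀ = ca i₀ j₀ (inject₁-mono⁻¹ i<j)
                            ∘ dominates-cong (lookup-old i₀) (lookup-old j₀) refl
    ... | old i₀ | new    = ca′ i₀ ∘ dominates-cong (lookup-old i₀) lookup-new refl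
    ... | new    | _      = contradiction i<j (fromℕ≮ j)

-- The floor of a sequence

nextFloor : ℕ → ℕ → ℕ → ℕ
nextFloor u w y = if does (w ≤? y) then u else w

nextFloor-rise : ∀ {u w y} → w ≤ y → nextFloor u w y ≡ u
nextFloor-rise {u} {w} {y} w≤y = cong (if_then u else w) (dec-true (w ≤? y) w≤y)

nextFloor-drop : ∀ {u w y} → y < w → nextFloor u w y ≡ w
nextFloor-drop {u} {w} {y} y<w = cong (if_then u else w) (dec-false (w ≤? y) (<⇒≱ y<w))

nextFloor-inv : ∀ a b y {u} → nextFloor a b y ≡ u → (b ≤ y × a ≡ u) ⊎ (y < b × b ≡ u)
nextFloor-inv a b y eq with b ≤? y
... | yes b≤y = inj₁ (b≤y , trans (sym (nextFloor-rise b≤y)) eq)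
... | no  b≰y = inj₂ (≰⇒> b≰y , trans (sym (nextFloor-drop (≰⇒> b≰y))) eq)

-- The second component is 1 + the last entry (0 for the empty sequence), so that the floor update needs
-- no special case for the first entry.
state : Vec ℕ n → ℕ × ℕ
state = foldl (λ _ → ℕ × ℕ) (λ (u , w) y → nextFloor u w y , suc y) (0 , 0)

floor lastSuc : Vec ℕ n → ℕ
floor   = proj₁ ∘ state
lastSuc = proj₂ ∘ state

state-∷ʳ : ∀ (v : Vec ℕ n) y → state (v ∷ʳ y) ≡ (nextFloor (floor v) (lastSuc v) y , suc y)
state-∷ʳ v y = foldl-∷ʳ (λ _ → ℕ × ℕ) _ (0 , 0) y v

floor-∷ʳ : ∀ (v : Vec ℕ n) y → floor (v ∷ʳ y) ≡ nextFloor (floor v) (lastSuc v) y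
floor-∷ʳ v y = cong proj₁ (state-∷ʳ v y)

lastSuc-∷ʳ : ∀ (v : Vec ℕ n) y → lastSuc (v ∷ʳ y) ≡ suc y
lastSuc-∷ʳ v y = cong proj₂ (state-∷ʳ v y)

lastSuc-last : ∀ (e : Vec ℕ (suc n)) → lastSuc e ≡ suc (last e)
lastSuc-last e with initLast e
... | v , y , refl = lastSuc-∷ʳ v y

record FloorInvariant (v : Vec ℕ n) (u w : ℕ) : Set where
  field
    canAppend⇔ : ∀ y → CanAppend v y ⇔ u ≤ y
    entry⇔     : ∀ t → u ≤ t → EntryAtLeast v t ⇔ t < w

open FloorInvariant

invariant-[] : FloorInvariant [] 0 0
invariant-[] .canAppend⇔ y   = mk⇔ (λ _ → z≤n) (λ _ ())
invariant-[] .entry⇔     t _ = mk⇔ (λ ()) (λ ())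

module _ {v : Vec ℕ n} {u w z : ℕ} (inv : FloorInvariant v u w) (u≤z : u ≤ z) where

  invariant-rise : w ≤ z → FloorInvariant (v ∷ʳ z) u (suc z)
  invariant-rise w≤z .canAppend⇔ y = mk⇔
    (to (inv .canAppend⇔ y) ∘ proj₁ ∘ to (CanAppend-∷ʳ v z))
    (λ u≤y → from (CanAppend-∷ʳ v z) (from (inv .canAppend⇔ y) u≤y ,
                                        λ i (z≤vᵢ , _) → <⇒≱ (to (inv .entry⇔ z u≤z) (i , z≤vᵢ)) w≤z))
  invariant-rise w≤z .entry⇔ t u≤t = mk⇔
    (λ e → [ (λ e₀ → ≤-trans (to (inv .entry⇔ t u≤t) e₀) (m≤n⇒m≤1+n w≤z)) , s≤s ]
             (to (EntryAtLeast-∷ʳ v z) e))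
    (from (EntryAtLeast-∷ʳ v z) ∘ inj₂ ∘ s≤s⁻¹)

  -- The old last entry dominates z, so it may not dominate any later entry: the floor jumps above it.
  invariant-drop : z < w → FloorInvariant (v ∷ʳ z) w (suc z)
  invariant-drop z<w .canAppend⇔ y = mk⇔ forth back
    where
    forth : CanAppend (v ∷ʳ z) y → w ≤ y
    forth ca = ≮⇒≥ λ y<w →
      let ca₀ , undominated = to (CanAppend-∷ʳ v z) ca
          i , z⊔y≤vᵢ = from (inv .entry⇔ (z ⊔ y) (≤-trans u≤z (m≤m⊔n z y))) (⊔-lub z<w y<w)
      in undominated i (≤-trans (m≤m⊔n z y) z⊔y≤vᵢ , ≤-trans (m≤n⊔m z y) z⊔y≤vᵢ)
    back : w ≤ y → CanAppend (v ∷ʳ z) y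
    back w≤y = from (CanAppend-∷ʳ v z) (from (inv .canAppend⇔ y) u≤y ,
                                        λ i (_ , y≤vᵢ) → <⇒≱ (to (inv .entry⇔ y u≤y) (i , y≤vᵢ)) w≤y)
      where u≤y = ≤-trans u≤z (≤-trans (<⇒≤ z<w) w≤y)
  invariant-drop z<w .entry⇔ t w≤t = mk⇔
    (λ e → ⊥-elim ([ (λ e₀ → <⇒≱ (to (inv .entry⇔ t u≤t) e₀) w≤t) , <⇒≱ z<t ]
                    (to (EntryAtLeast-∷ʳ v z) e)))
    (⊥-elim ∘ <⇒≱ z<t ∘ s≤s⁻¹)
    where
    z<t = <-≤-trans z<w w≤t
    u≤t = ≤-trans u≤z (<⇒≤ z<t)

  invariant-∷ʳ : FloorInvariant (v ∷ʳ z) (nextFloor u w z) (suc z)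
  invariant-∷ʳ with w ≤? z
  ... | yes w≤z = subst (λ u′ → FloorInvariant _ u′ _) (sym (nextFloor-rise w≤z)) (invariant-rise w≤z)
  ... | no  w≰z = let z<w = ≰⇒> w≰z in
                  subst (λ u′ → FloorInvariant _ u′ _) (sym (nextFloor-drop z<w)) (invariant-drop z<w)

floorInvariant : (v : Vec ℕ n) → Avoids≥-≥ v → FloorInvariant v (floor v) (lastSuc v)
floorInvariant =
  snoc-induction (λ v → Avoids≥-≥ v → FloorInvariant v (floor v) (lastSuc v)) (λ _ → invariant-[]) step
  where
  step : ∀ {n} (v : Vec ℕ n) z → (Avoids≥-≥ v → FloorInvariant v (floor v) (lastSuc v)) →
         Avoids≥-≥ (v ∷ʳ z) → FloorInvariant (v ∷ʳ z) (floor (v ∷ʳ z)) (lastSuc (v ∷ʳ z))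
  step v z ih av =
    let av₀ , ca = to (Avoids-∷ʳ v z) av
        inv      = ih av₀
    in subst (λ s → FloorInvariant (v ∷ʳ z) (proj₁ s) (proj₂ s)) (sym (state-∷ʳ v z))
             (invariant-∷ʳ inv (to (inv .canAppend⇔ z) ca))

Good-∷ʳ : ∀ (v : Vec ℕ n) y → Good (v ∷ʳ y) ⇔ (Good v × y ≤ n × floor v ≤ y)
Good-∷ʳ v y = mk⇔
  (λ (inv , av) → let inv₀ , y≤n = to (IsInvSeq-∷ʳ v y) inv
                      av₀ , ca   = to (Avoids-∷ʳ v y) av
                  in (inv₀ , av₀) , y≤n , to (floorInvariant v av₀ .canAppend⇔ y) ca)
  (λ ((inv₀ , av₀) , y≤n , floor≤y) →
       from (IsInvSeq-∷ʳ v y) (inv₀ , y≤n)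
     , from (Avoids-∷ʳ v y) (av₀ , from (floorInvariant v av₀ .canAppend⇔ y) floor≤y))

state-bounds : (v : Vec ℕ n) → IsInvSeq v → floor v ≤ n × lastSuc v ≤ n
state-bounds = snoc-induction (λ {n} v → IsInvSeq v → floor v ≤ n × lastSuc v ≤ n) (λ _ → z≤n , z≤n) step
  where
  nextFloor-≤ : ∀ {u w y b} → u ≤ b → w ≤ b → nextFloor u w y ≤ b
  nextFloor-≤ {w = w} {y} u≤b w≤b with w ≤? y
  ... | yes w≤y = subst (_≤ _) (sym (nextFloor-rise w≤y)) u≤b
  ... | no  w≰y = subst (_≤ _) (sym (nextFloor-drop (≰⇒> w≰y))) w≤b
  step : ∀ {n} (v : Vec ℕ n) y → (IsInvSeq v → floor v ≤ n × lastSuc v ≤ n) →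
         IsInvSeq (v ∷ʳ y) → floor (v ∷ʳ y) ≤ suc n × lastSuc (v ∷ʳ y) ≤ suc n
  step v y ih inv =
    let inv₀ , y≤n = to (IsInvSeq-∷ʳ v y) inv
        u≤n , w≤n  = ih inv₀
    in subst (λ s → proj₁ s ≤ suc _ × proj₂ s ≤ suc _) (sym (state-∷ʳ v y))
             (nextFloor-≤ (m≤n⇒m≤1+n u≤n) (m≤n⇒m≤1+n w≤n) , s≤s y≤n)

-- Counting sequences by floor and last entry

stateCount : ℕ → ℕ → ℕ → ℕ → ℕ
stateCount B m u w = count (λ v → good? v ×-dec (floor v ≟ u ×-dec lastSuc v ≟ w)) (allVecs B m)

count-by-state : ∀ {Φ : ℕ → ℕ → Set} (Φ? : ∀ a b → Dec (Φ a b)) B m →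
                 count (λ v → good? v ×-dec Φ? (floor v) (lastSuc v)) (allVecs B m) ≡
                 ∑[ a < suc m ] ∑[ b < suc m ] (stateCount B m a b if? Φ? a b)
count-by-state {Φ} Φ? B m = begin
  count P? L
    ≡⟨ count-partition P? floor (suc m) (λ {v} ((inv , _) , _) → s≤s (proj₁ (state-bounds v inv))) L ⟩
  ∑[ a < suc m ] count (Pᵃ? a) L
    ≡⟨ ∑-cong (suc m) (λ a _ → count-partition (Pᵃ? a) lastSuc (suc m)
                                 (λ {v} (((inv , _) , _) , _) → s≤s (proj₂ (state-bounds v inv))) L) ⟩
  ∑[ a < suc m ] ∑[ b < suc m ] count (Pᵃᵇ? a b) L
    ≡⟨ ∑-cong (suc m) (λ a _ → ∑-cong (suc m) (λ b _ →
         count-≐ (Pᵃᵇ? a b) (Qᵃᵇ? a b) (reassociate a b) L)) ⟩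
  ∑[ a < suc m ] ∑[ b < suc m ] count (Qᵃᵇ? a b) L
    ≡⟨ ∑-cong (suc m) (λ a _ → ∑-cong (suc m) (λ b _ →
         count-×-const (Φ? a b) (λ v → good? v ×-dec (floor v ≟ a ×-dec lastSuc v ≟ b)) L)) ⟩
  ∑[ a < suc m ] ∑[ b < suc m ] (stateCount B m a b if? Φ? a b) ∎
  where
  open ≡-Reasoning
  L = allVecs B m
  P? : (v : Vec ℕ m) → Dec (Good v × Φ (floor v) (lastSuc v))
  P? v = good? v ×-dec Φ? (floor v) (lastSuc v)
  Pᵃ? : ∀ a (v : Vec ℕ m) → Dec ((Good v × Φ (floor v) (lastSuc v)) × floor v ≡ a)
  Pᵃ? a v = P? v ×-dec floor v ≟ a
  Pᵃᵇ? : ∀ a b (v : Vec ℕ m) → Dec (((Good v × Φ (floor v) (lastSuc v)) × floor v ≡ a) × lastSuc v ≡ b)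
  Pᵃᵇ? a b v = Pᵃ? a v ×-dec lastSuc v ≟ b
  Qᵃᵇ? : ∀ a b (v : Vec ℕ m) → Dec (Φ a b × Good v × floor v ≡ a × lastSuc v ≡ b)
  Qᵃᵇ? a b v = Φ? a b ×-dec (good? v ×-dec (floor v ≟ a ×-dec lastSuc v ≟ b))
  reassociate : ∀ a b → (λ (v : Vec ℕ m) → ((Good v × Φ (floor v) (lastSuc v)) × floor v ≡ a) × lastSuc v ≡ b)
                      ≐ (λ v → Φ a b × Good v × floor v ≡ a × lastSuc v ≡ b)
  reassociate a b = (λ { (((g , φ) , refl) , refl) → φ , g , refl , refl })
                  , (λ { (φ , g , refl , refl) → ((g , φ) , refl) , refl })

predecessors : ℕ → (ℕ → ℕ → ℕ) → ℕ → ℕ → ℕ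
predecessors R X u y = ∑[ a < R ] ∑[ b < R ] (X a b if? (a ≤? y ×-dec nextFloor a b y ≟ u))

Good-∷ʳ-state : ∀ (v : Vec ℕ n) {u w} y →
                (Good (v ∷ʳ y) × floor (v ∷ʳ y) ≡ u × lastSuc (v ∷ʳ y) ≡ w) ⇔
                ((suc y ≡ w × y ≤ n) × Good v × floor v ≤ y × nextFloor (floor v) (lastSuc v) y ≡ u)
Good-∷ʳ-state v y = mk⇔
  (λ (g , floor≡u , lastSuc≡w) →
    let g₀ , y≤n , floor≤y = to (Good-∷ʳ v y) g
    in (trans (sym (lastSuc-∷ʳ v y)) lastSuc≡w , y≤n) , g₀ , floor≤y , trans (sym (floor-∷ʳ v y)) floor≡u)
  (λ ((1+y≡w , y≤n) , g₀ , floor≤y , next≡u) →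
    from (Good-∷ʳ v y) (g₀ , y≤n , floor≤y) , trans (floor-∷ʳ v y) next≡u , trans (lastSuc-∷ʳ v y) 1+y≡w)

stateCount-by-last : ∀ B m u w →
  stateCount B (suc m) u w ≡ ∑[ y < B ] (predecessors (suc m) (stateCount B m) u y if? (suc y ≟ w ×-dec y ≤? m))
stateCount-by-last B m u w = begin
  stateCount B (suc m) u w
    ≡⟨ count-allVecs-∷ʳ _ B ⟩
  ∑[ y < B ] count (λ v → good? (v ∷ʳ y) ×-dec (floor (v ∷ʳ y) ≟ u ×-dec lastSuc (v ∷ʳ y) ≟ w)) L
    ≡⟨ ∑-cong B (λ y _ → count-≐ _ (λ v → last? y ×-dec Q? y v)
                                  ((λ {v} → to (Good-∷ʳ-state v y)) , (λ {v} → from (Good-∷ʳ-state v y))) L) ⟩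
  ∑[ y < B ] count (λ v → last? y ×-dec Q? y v) L
    ≡⟨ ∑-cong B (λ y _ → count-×-const (last? y) (Q? y) L) ⟩
  ∑[ y < B ] (count (Q? y) L if? last? y)
    ≡⟨ ∑-cong B (λ y _ → cong (_if? last? y) (count-by-state (Φ? y) B m)) ⟩
  ∑[ y < B ] (predecessors (suc m) (stateCount B m) u y if? last? y) ∎
  where
  open ≡-Reasoning
  L = allVecs B m
  last? : ∀ y → Dec (suc y ≡ w × y ≤ m)
  last? y = suc y ≟ w ×-dec y ≤? m
  Φ? : ∀ y a b → Dec (a ≤ y × nextFloor a b y ≡ u)
  Φ? y a b = a ≤? y ×-dec nextFloor a b y ≟ u
  Q? : ∀ y (v : Vec ℕ m) → Dec (Good v × floor v ≤ y × nextFloor (floor v) (lastSuc v) y ≡ u)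
  Q? y v = good? v ×-dec Φ? y (floor v) (lastSuc v)

stateCount-lastSuc-zero : ∀ B m u → stateCount B (suc m) u 0 ≡ 0
stateCount-lastSuc-zero B m u =
  trans (stateCount-by-last B m u 0)
        (∑-zero B (λ y _ → if?-no (suc y ≟ 0 ×-dec y ≤? m) {predecessors (suc m) (stateCount B m) u y} λ ()))

stateCount-∷ʳ : ∀ {B m} → m < B → ∀ u y →
                stateCount B (suc m) u (suc y) ≡ predecessors (suc m) (stateCount B m) u y if? (y ≤? m)
stateCount-∷ʳ {B} {m} m<B u y₀ = trans (stateCount-by-last B m u (suc y₀)) (by-cases (y₀ ≤? m))
  where
  Y = predecessors (suc m) (stateCount B m) u
  by-cases : Dec (y₀ ≤ m) → ∑[ y < B ] (Y y if? (suc y ≟ suc y₀ ×-dec y ≤? m)) ≡ Y y₀ if? (y₀ ≤? m)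
  by-cases (yes y₀≤m) = begin
    ∑[ y < B ] (Y y if? (suc y ≟ suc y₀ ×-dec y ≤? m))
      ≡⟨ ∑-single B y₀ (≤-<-trans y₀≤m m<B)
           (λ y _ y≢y₀ → if?-no (suc y ≟ suc y₀ ×-dec y ≤? m) (y≢y₀ ∘ suc-injective ∘ proj₁)) ⟩
    Y y₀ if? (suc y₀ ≟ suc y₀ ×-dec y₀ ≤? m)
      ≡⟨ if?-cong (suc y₀ ≟ suc y₀ ×-dec y₀ ≤? m) (y₀ ≤? m) proj₂ (refl ,_) ⟩
    Y y₀ if? (y₀ ≤? m) ∎
    where open ≡-Reasoning
  by-cases (no y₀≰m) = trans
    (∑-zero B (λ y _ → if?-no (suc y ≟ suc y₀ ×-dec y ≤? m)
                        (λ (1+y≡1+y₀ , y≤m) → y₀≰m (subst (_≤ m) (suc-injective 1+y≡1+y₀) y≤m))))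
    (sym (if?-no (y₀ ≤? m) y₀≰m))

module _ (R : ℕ) (X : ℕ → ℕ → ℕ) {u l : ℕ} where

  private
    step? : ∀ a b → Dec (a ≤ l × nextFloor a b l ≡ u)
    step? a b = a ≤? l ×-dec nextFloor a b l ≟ u
    F : ℕ → ℕ → ℕ
    F a b = X a b if? step? a b

  predecessors-rise : u ≤ l → l < R → predecessors R X u l ≡ ∑[ b < suc l ] X u b
  predecessors-rise u≤l l<R = begin
    ∑[ a < R ] ∑[ b < R ] F a b
      ≡⟨ ∑-single R u (≤-<-trans u≤l l<R)
           (λ a _ a≢u → ∑-zero R (λ b _ → if?-no (step? a b) (other {a} {b} a≢u))) ⟩
    ∑[ b < R ] F u b
      ≡⟨ ∑-cong R (λ b _ → if?-cong (step? u b) (b <? suc l) (b≤l {b} ∘ proj₂)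
                                    (λ b<1+l → u≤l , nextFloor-rise (s≤s⁻¹ b<1+l))) ⟩
    ∑[ b < R ] (X u b if? (b <? suc l))
      ≡⟨ ∑-truncate (suc l) (X u) l<R ⟩
    ∑[ b < suc l ] X u b ∎
    where
    open ≡-Reasoning
    other : ∀ {a b} → a ≢ u → ¬ (a ≤ l × nextFloor a b l ≡ u)
    other {a} {b} a≢u (_ , eq) with nextFloor-inv a b l eq
    ... | inj₁ (_ , a≡u)   = a≢u a≡u
    ... | inj₂ (l<b , b≡u) = <⇒≱ l<b (subst (_≤ l) (sym b≡u) u≤l)
    b≤l : ∀ {b} → nextFloor u b l ≡ u → b < suc l
    b≤l {b} eq with nextFloor-inv u b l eq
    ... | inj₁ (b≤l , _)   = s≤s b≤l
    ... | inj₂ (l<b , b≡u) = contradiction (subst (_≤ l) (sym b≡u) u≤l) (<⇒≱ l<b)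

  predecessors-drop : l < u → predecessors R X u l ≡ ∑[ a < suc l ] X a u if? (u <? R)
  predecessors-drop l<u = by-cases (u <? R)
    where
    by-cases : Dec (u < R) → ∑[ a < R ] ∑[ b < R ] F a b ≡ ∑[ a < suc l ] X a u if? (u <? R)
    by-cases (no u≮R) =
      trans (∑-zero R (λ a _ → ∑-zero R (λ b b<R → if?-no (step? a b) (impossible {a} b<R))))
            (sym (if?-no (u <? R) u≮R))
      where
      impossible : ∀ {a b} → b < R → ¬ (a ≤ l × nextFloor a b l ≡ u)
      impossible {a} {b} b<R (a≤l , eq) with nextFloor-inv a b l eq
      ... | inj₁ (_ , refl) = <⇒≱ l<u a≤l
      ... | inj₂ (_ , refl) = u≮R b<R
    by-cases (yes u<R) = begin
      ∑[ a < R ] ∑[ b < R ] F a b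
        ≡⟨ ∑-cong R (λ a _ → ∑-single R u u<R (λ b _ b≢u → if?-no (step? a b) (other b≢u))) ⟩
      ∑[ a < R ] F a u
        ≡⟨ ∑-cong R (λ a _ → if?-cong (step? a u) (a <? suc l) (s≤s ∘ proj₁)
                                      (λ a<1+l → s≤s⁻¹ a<1+l , nextFloor-drop l<u)) ⟩
      ∑[ a < R ] (X a u if? (a <? suc l))
        ≡⟨ ∑-truncate (suc l) (λ a → X a u) (≤-trans l<u (<⇒≤ u<R)) ⟩
      ∑[ a < suc l ] X a u
        ≡⟨ if?-yes (u <? R) u<R ⟨
      ∑[ a < suc l ] X a u if? (u <? R) ∎
      where
      open ≡-Reasoning
      other : ∀ {a b} → b ≢ u → ¬ (a ≤ l × nextFloor a b l ≡ u)
      other {a} {b} b≢u (a≤l , eq) with nextFloor-inv a b l eq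
      ... | inj₁ (_ , refl) = <⇒≱ l<u a≤l
      ... | inj₂ (_ , b≡u)  = b≢u b≡u

-- Closed form of the counts

-- The cut-off makes ballot (suc p) (2p + 2) vanish: no sequence of length p + 2 has floor and last entry
-- both equal to p + 1.
ballot : ℕ → ℕ → ℕ
ballot zero    t = 1 if? (t ≟ 0)
ballot (suc p) t = ∑< t (ballot p) if? (t ≤? p + suc p)

ballot-below : ∀ p {t} → t < p → ballot p t ≡ 0
ballot-below (suc p) {t} t<1+p =
  trans (cong (_if? (t ≤? p + suc p)) (∑-zero t (λ s s<t → ballot-below p (<-≤-trans s<t (s≤s⁻¹ t<1+p)))))
        (if?-zero (t ≤? p + suc p))

ballot-above : ∀ p {t} → p + suc p < t → ballot (suc p) t ≡ 0
ballot-above p {t} 2p+1<t = if?-no (t ≤? p + suc p) (<⇒≱ 2p+1<t)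

ballot-prefix : ∀ p {k} → k ≤ p → ballot (suc p) (suc p + k) ≡ ∑< (suc p + k) (ballot p)
ballot-prefix p {k} k≤p =
  if?-yes (suc p + k ≤? p + suc p) (subst (suc p + k ≤_) (sym (+-suc p p)) (s≤s (+-monoʳ-≤ p k≤p)))

∑-ballot : ∀ p {s n} → s ≤ p → s + n ≤ p + suc p → ∑[ i < n ] ballot p (s + i) ≡ ballot (suc p) (s + n)
∑-ballot p {s} {n} s≤p s+n≤2p+1 = sym (begin
  ballot (suc p) (s + n)
    ≡⟨ if?-yes (s + n ≤? p + suc p) s+n≤2p+1 ⟩
  ∑< (s + n) (ballot p)
    ≡⟨ ∑-+ s n (ballot p) ⟩
  ∑< s (ballot p) + ∑[ i < n ] ballot p (s + i)
    ≡⟨ cong (_+ ∑[ i < n ] ballot p (s + i)) (∑-zero s (λ t t<s → ballot-below p (<-≤-trans t<s s≤p))) ⟩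
  ∑[ i < n ] ballot p (s + i) ∎)
  where open ≡-Reasoning

ClosedForm : ℕ → ℕ → Set
ClosedForm B p = ∀ u l → stateCount B (suc p) u (suc l) ≡ ballot p (u + l) if? (u ≤? p ×-dec l ≤? p)

module _ {B p} (ih : ClosedForm B p) {u l : ℕ} (l≤1+p : l ≤ suc p) where

  private
    X = stateCount B (suc p)

  closedForm-rise : u ≤ l → predecessors (suc (suc p)) X u l ≡ ballot (suc p) (u + l) if? (u ≤? suc p)
  closedForm-rise u≤l = begin
    predecessors (suc (suc p)) X u l
      ≡⟨ predecessors-rise (suc (suc p)) X u≤l (s≤s l≤1+p) ⟩
    X u 0 + ∑[ b < l ] X u (suc b)
      ≡⟨ cong₂ _+_ (stateCount-lastSuc-zero B p u) (∑-cong l (λ b _ → ih u b)) ⟩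
    ∑[ b < l ] (ballot p (u + b) if? (u ≤? p ×-dec b ≤? p))
      ≡⟨ by-cases (u ≤? p) ⟩
    ballot (suc p) (u + l) if? (u ≤? suc p) ∎
    where
    open ≡-Reasoning
    by-cases : Dec (u ≤ p) →
               ∑[ b < l ] (ballot p (u + b) if? (u ≤? p ×-dec b ≤? p)) ≡ ballot (suc p) (u + l) if? (u ≤? suc p)
    by-cases (yes u≤p) = begin
      ∑[ b < l ] (ballot p (u + b) if? (u ≤? p ×-dec b ≤? p))
        ≡⟨ ∑-cong l (λ b b<l → if?-yes (u ≤? p ×-dec b ≤? p) (u≤p , s≤s⁻¹ (<-≤-trans b<l l≤1+p))) ⟩
      ∑[ b < l ] ballot p (u + b)
        ≡⟨ ∑-ballot p u≤p (+-mono-≤ u≤p l≤1+p) ⟩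
      ballot (suc p) (u + l)
        ≡⟨ if?-yes (u ≤? suc p) (m≤n⇒m≤1+n u≤p) ⟨
      ballot (suc p) (u + l) if? (u ≤? suc p) ∎
    by-cases (no u≰p) = begin
      ∑[ b < l ] (ballot p (u + b) if? (u ≤? p ×-dec b ≤? p))
        ≡⟨ ∑-zero l (λ b _ → if?-no (u ≤? p ×-dec b ≤? p) (u≰p ∘ proj₁)) ⟩
      0
        ≡⟨ if?-zero (u ≤? suc p) ⟨
      0 if? (u ≤? suc p)
        ≡⟨ cong (_if? (u ≤? suc p)) (ballot-above p (+-mono-≤ (≰⇒> u≰p) (<-≤-trans (≰⇒> u≰p) u≤l))) ⟨
      ballot (suc p) (u + l) if? (u ≤? suc p) ∎

  closedForm-drop : l < u → predecessors (suc (suc p)) X u l ≡ ballot (suc p) (u + l) if? (u ≤? suc p)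
  closedForm-drop l<u@(s≤s {n = u₀} l≤u₀) = begin
    predecessors (suc (suc p)) X u l
      ≡⟨ predecessors-drop (suc (suc p)) X l<u ⟩
    ∑[ a < suc l ] X a u if? (u <? suc (suc p))
      ≡⟨ cong (_if? (u <? suc (suc p))) (∑-cong (suc l) (λ a _ → ih a u₀)) ⟩
    ∑[ a < suc l ] (ballot p (a + u₀) if? (a ≤? p ×-dec u₀ ≤? p)) if? (u <? suc (suc p))
      ≡⟨ by-cases (u₀ ≤? p) ⟩
    ballot (suc p) (u + l) if? (u ≤? suc p) ∎
    where
    open ≡-Reasoning
    by-cases : Dec (u₀ ≤ p) →
               ∑[ a < suc l ] (ballot p (a + u₀) if? (a ≤? p ×-dec u₀ ≤? p)) if? (u <? suc (suc p)) ≡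
               ballot (suc p) (u + l) if? (u ≤? suc p)
    by-cases (yes u₀≤p) = begin
      ∑[ a < suc l ] (ballot p (a + u₀) if? (a ≤? p ×-dec u₀ ≤? p)) if? (u <? suc (suc p))
        ≡⟨ if?-yes (u <? suc (suc p)) (s≤s (s≤s u₀≤p)) ⟩
      ∑[ a < suc l ] (ballot p (a + u₀) if? (a ≤? p ×-dec u₀ ≤? p))
        ≡⟨ ∑-cong (suc l) (λ a a<1+l → trans (if?-yes (a ≤? p ×-dec u₀ ≤? p) (a≤p a<1+l , u₀≤p))
                                              (cong (ballot p) (+-comm a u₀))) ⟩
      ∑[ a < suc l ] ballot p (u₀ + a)
        ≡⟨ ∑-ballot p u₀≤p (+-mono-≤ u₀≤p (s≤s (≤-trans l≤u₀ u₀≤p))) ⟩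
      ballot (suc p) (u₀ + suc l)
        ≡⟨ cong (ballot (suc p)) (+-suc u₀ l) ⟩
      ballot (suc p) (u + l)
        ≡⟨ if?-yes (u ≤? suc p) (s≤s u₀≤p) ⟨
      ballot (suc p) (u + l) if? (u ≤? suc p) ∎
      where
      a≤p : ∀ {a} → a < suc l → a ≤ p
      a≤p a<1+l = ≤-trans (s≤s⁻¹ a<1+l) (≤-trans l≤u₀ u₀≤p)
    by-cases (no u₀≰p) = trans (if?-no (u <? suc (suc p)) (u₀≰p ∘ s≤s⁻¹ ∘ s≤s⁻¹))
                               (sym (if?-no (u ≤? suc p) (u₀≰p ∘ s≤s⁻¹)))

closedForm : ∀ {B} p → p < B → ClosedForm B p
closedForm {B} zero 0<B u l = trans (stateCount-∷ʳ 0<B u l) (base u l)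
  where
  base : ∀ u l → predecessors 1 (stateCount B 0) u l if? (l ≤? 0) ≡ ballot 0 (u + l) if? (u ≤? 0 ×-dec l ≤? 0)
  base zero    zero    = refl
  base zero    (suc l) = refl
  base (suc u) zero    = refl
  base (suc u) (suc l) = refl
closedForm {B} (suc p) 1+p<B u l = trans (stateCount-∷ʳ 1+p<B u l) (by-cases (l ≤? suc p))
  where
  ih : ClosedForm B p
  ih = closedForm p (<-trans (n<1+n p) 1+p<B)
  Y = predecessors (suc (suc p)) (stateCount B (suc p)) u l
  by-cases : Dec (l ≤ suc p) → Y if? (l ≤? suc p) ≡ ballot (suc p) (u + l) if? (u ≤? suc p ×-dec l ≤? suc p)
  by-cases (no l≰1+p)  =
    trans (if?-no (l ≤? suc p) l≰1+p) (sym (if?-no (u ≤? suc p ×-dec l ≤? suc p) (l≰1+p ∘ proj₂)))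
  by-cases (yes l≤1+p) = begin
    Y if? (l ≤? suc p)
      ≡⟨ if?-yes (l ≤? suc p) l≤1+p ⟩
    Y
      ≡⟨ rise-or-drop ⟩
    ballot (suc p) (u + l) if? (u ≤? suc p)
      ≡⟨ if?-cong (u ≤? suc p) (u ≤? suc p ×-dec l ≤? suc p) (_, l≤1+p) proj₁ ⟩
    ballot (suc p) (u + l) if? (u ≤? suc p ×-dec l ≤? suc p) ∎
    where
    open ≡-Reasoning
    rise-or-drop : Y ≡ ballot (suc p) (u + l) if? (u ≤? suc p)
    rise-or-drop with u ≤? l
    ... | yes u≤l = closedForm-rise {B} {p} ih l≤1+p u≤l
    ... | no  u≰l = closedForm-drop {B} {p} ih l≤1+p (≰⇒> u≰l)

C-by-state : ∀ m k →
  C (suc m) k ≡ ∑[ a < suc (suc m) ] ∑[ b < suc (suc m) ] (stateCount (suc m) (suc m) a b if? (b ≟ suc k))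
C-by-state m k = trans
  (count-≐ _ (λ e → good? e ×-dec lastSuc e ≟ suc k)
           ( (λ {e} (g , last≡k) → g , trans (lastSuc-last e) (cong suc last≡k))
           , (λ {e} (g , lastSuc≡1+k) → g , suc-injective (trans (sym (lastSuc-last e)) lastSuc≡1+k)))
           (allVecs (suc m) (suc m)))
  (count-by-state (λ _ b → b ≟ suc k) (suc m) (suc m))

C-ballot : ∀ p k → C (suc p) k ≡ ballot (suc p) (suc p + k)
C-ballot p k = trans (C-by-state p k) (by-cases (k ≤? p))
  where
  X = stateCount (suc p) (suc p)
  by-cases : Dec (k ≤ p) →
             ∑[ a < suc (suc p) ] ∑[ b < suc (suc p) ] (X a b if? (b ≟ suc k)) ≡ ballot (suc p) (suc p + k)
  by-cases (yes k≤p) = begin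
    ∑[ a < suc (suc p) ] ∑[ b < suc (suc p) ] (X a b if? (b ≟ suc k))
      ≡⟨ ∑-cong (suc (suc p)) (λ a _ →
           trans (∑-single (suc (suc p)) (suc k) (s≤s (s≤s k≤p))
                           (λ b _ b≢1+k → if?-no (b ≟ suc k) {X a b} b≢1+k))
                 (if?-yes (suc k ≟ suc k) refl)) ⟩
    ∑[ a < suc (suc p) ] X a (suc k)
      ≡⟨ ∑-cong (suc (suc p)) (λ a _ →
           trans (closedForm p ≤-refl a k)
                 (if?-cong (a ≤? p ×-dec k ≤? p) (a <? suc p) (s≤s ∘ proj₁)
                           (λ a<1+p → s≤s⁻¹ a<1+p , k≤p))) ⟩
    ∑[ a < suc (suc p) ] (ballot p (a + k) if? (a <? suc p))
      ≡⟨ ∑-truncate (suc p) (λ a → ballot p (a + k)) (n≤1+n (suc p)) ⟩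
    ∑[ a < suc p ] ballot p (a + k)
      ≡⟨ ∑-cong (suc p) (λ a _ → cong (ballot p) (+-comm a k)) ⟩
    ∑[ a < suc p ] ballot p (k + a)
      ≡⟨ ∑-ballot p k≤p (+-monoˡ-≤ (suc p) k≤p) ⟩
    ballot (suc p) (k + suc p)
      ≡⟨ cong (ballot (suc p)) (+-comm k (suc p)) ⟩
    ballot (suc p) (suc p + k) ∎
    where open ≡-Reasoning
  by-cases (no k≰p) = begin
    ∑[ a < suc (suc p) ] ∑[ b < suc (suc p) ] (X a b if? (b ≟ suc k))
      ≡⟨ ∑-zero (suc (suc p)) (λ a _ → ∑-zero (suc (suc p)) (λ b b<2+p →
           if?-no (b ≟ suc k) {X a b} (λ { refl → k≰p (s≤s⁻¹ (s≤s⁻¹ b<2+p)) }))) ⟩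
    0
      ≡⟨ ballot-above p (subst (_< suc p + k) (sym (+-suc p p)) (+-monoʳ-< (suc p) (≰⇒> k≰p))) ⟨
    ballot (suc p) (suc p + k) ∎
    where open ≡-Reasoning

Cpred-ballot : ∀ p k → k ≤ p → Cpred (suc p) k ≡ ∑< (p + k) (ballot p)
Cpred-ballot p zero    _     = sym (∑-zero (p + 0) (λ s s<p+0 → ballot-below p (subst (s <_) (+-identityʳ p) s<p+0)))
Cpred-ballot p (suc k) 1+k≤p = begin
  C (suc p) k                  ≡⟨ C-ballot p k ⟩
  ballot (suc p) (suc p + k)   ≡⟨ ballot-prefix p (<⇒≤ 1+k≤p) ⟩
  ∑< (suc p + k) (ballot p)    ≡⟨ cong (λ t → ∑< t (ballot p)) (+-suc p k) ⟨
  ∑< (p + suc k) (ballot p)    ∎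
  where open ≡-Reasoning

proposition2p1 : ∀ (n k : ℕ) → 2 ≤ n → k ≤ n ∸ 1 →
    C n k ≡ Cpred n k + C (n ∸ 1) k
proposition2p1 (suc zero)    k (s≤s ()) _
proposition2p1 (suc (suc q)) k _        k≤1+q = begin
  C (suc p) k                                ≡⟨ C-ballot p k ⟩
  ballot (suc p) (suc p + k)                 ≡⟨ ballot-prefix p k≤1+q ⟩
  ∑< (suc (p + k)) (ballot p)                ≡⟨ ∑-suc (p + k) (ballot p) ⟩
  ∑< (p + k) (ballot p) + ballot p (p + k)   ≡⟨ cong₂ _+_ (Cpred-ballot p k k≤1+q) (C-ballot q k) ⟨
  Cpred (suc p) k + C p k                    ∎
  where
  open ≡-Reasoning
  p = suc q
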